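{- For every integer $n \geq 2$, \[w_{2n+1,8}^{+}=w_{2n+1,8}^{ - }=\frac{2^{6n-2n-7}(2^{2n+3}-8)}{3}\] and \[w_{2n,8}=28 \times 8^{n-2}+\frac{2^{4n-5}-2^{3n-3}+2^{6n-6}-2^{3n}}{3}.\]
   Context: For $a_1,\ldots,a_n\in\mathbb{Z}/8\mathbb{Z}$, $M_{n}(a_1,\ldots,a_n):=\begin{pmatrix} a_{n} & -1 \\ 1 & 0\end{pmatrix}\cdots\begin{pmatrix} a_{1} & -1 \\ 1 & 0\end{pmatrix}$. Let $w_{n,8}^{+}$ (resp. $w_{n,8}^{ - }$) be the number of $(a_1,\ldots,a_n)\in(\mathbb{Z}/8\mathbb{Z})^n$ with $M_n(a_1,\ldots,a_n)=Id$ (resp. $=-Id$), and $w_{n,8}:=w_{n,8}^{+}+w_{n,8}^{ - }$. -}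

module Defs where

open import Data.Nat using (ℕ; zero; suc)
open import Data.Fin using (Fin)
open import Data.Fin.Base using (toℕ; fromℕ<)
open import Data.Nat.DivMod using (_%_; m%n<n)
open import Data.Vec using (Vec; []; _∷_)
open import Data.List using (List; []; _∷_; length; filter; map; concatMap)
import Data.List
open import Data.Product using (_×_; _,_)
open import Relation.Binary.PropositionalEquality using (_≡_)
open import Relation.Nullary using (Dec)
import Data.Fin.Properties as FinP
open import Data.Product.Properties using (≡-dec)

Z8 : Set
Z8 = Fin 8

[_]₈ : ℕ → Z8
[ m ]₈ = fromℕ< (m%n<n m 8)

infixl 6 _+₈_
infixl 7 _*₈_
_+₈_ : Z8 → Z8 → Z8
a +₈ b = [ toℕ a Data.Nat.+ toℕ b ]₈

_*₈_ : Z8 → Z8 → Z8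
a *₈ b = [ toℕ a Data.Nat.* toℕ b ]₈

-₈_ : Z8 → Z8
-₈ a = [ 8 Data.Nat.∸ toℕ a ]₈

0₈ 1₈ : Z8
0₈ = [ 0 ]₈
1₈ = [ 1 ]₈

-- 2x2 matrices over Z/8Z, ((a , b) , (c , d)) = [[a, b], [c, d]]
Mat : Set
Mat = (Z8 × Z8) × (Z8 × Z8)

_·_ : Mat → Mat → Mat
((a , b) , (c , d)) · ((e , f) , (g , h)) =
  ((a *₈ e +₈ b *₈ g , a *₈ f +₈ b *₈ h) , (c *₈ e +₈ d *₈ g , c *₈ f +₈ d *₈ h))

Id : Mat
Id = ((1₈ , 0₈) , (0₈ , 1₈))

-Id : Mat
-Id = ((-₈ 1₈ , 0₈) , (0₈ , -₈ 1₈))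

S : Z8 → Mat
S a = ((a , -₈ 1₈) , (1₈ , 0₈))

-- M_n(a_1,...,a_n) = S(a_n) ⋯ S(a_1); the vector lists a_1 first.
M : ∀ {n} → Vec Z8 n → Mat
M {n} v = go v Id
  where
  go : ∀ {k} → Vec Z8 k → Mat → Mat
  go [] acc = acc
  go (a ∷ as) acc = go as (S a · acc)

_≟M_ : (A B : Mat) → Dec (A ≡ B)
_≟M_ = ≡-dec (≡-dec FinP._≟_ FinP._≟_) (≡-dec FinP._≟_ FinP._≟_)

tuples : (n : ℕ) → List (Vec Z8 n)
tuples zero = [] ∷ []
tuples (suc n) = concatMap (λ a → map (a ∷_) (tuples n)) (Data.List.allFin 8)

w⁺ : ℕ → ℕ
w⁺ n = length (filter (λ v → M v ≟M Id) (tuples n))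

w⁻ : ℕ → ℕ
w⁻ n = length (filter (λ v → M v ≟M -Id) (tuples n))

w : ℕ → ℕ
w n = w⁺ n Data.Nat.+ w⁻ n

{-# OPTIONS --safe #-}
module Submission where

-- Reading a word letter by letter multiplies on the left by the matrices S a, so w⁺ n and w⁻ n
-- count walks of length n from Id to Id and to -Id.  As S a sends the rows (r , s) of a matrix
-- to (a r - s , r), and in a matrix of determinant 1 the row s is determined by r up to adding
-- multiples of r, the multiset of first rows of the S a · X depends only on the first row of X.
-- So the walk counts are coordinates of the orbit of a linear operator on ℕ^67, one coordinate
-- for each first row and three for det ≠ 1, Id and -Id.  From time 2 on, every coordinate
-- satisfies the recurrence in steps of 2 whose characteristic polynomial, in y = x², is
-- (y - 8)(y + 8)(y - 16)(y + 16)(y - 64): by linearity it suffices to check this once, at time 2.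
-- Solutions of this recurrence are determined by five values, which pins down the closed forms.

open import Defs
open import Data.Nat using (ℕ)
open import Data.Fin using (Fin)
open import Data.Vec using (Vec)
open import Data.List using (List)

module LinearRecurrences where

  open import Data.Nat using (zero; suc; _+_; _*_; _^_; _≤_; _<_; s≤s; z≤n)
  open import Data.Nat.Properties
    using (*-zeroʳ; *-identityˡ; +-identityʳ; +-assoc; *-distribˡ-+; *-suc; ^-distribˡ-+-*;
           +-cancelˡ-≡; m≤m+n; ≤-pred; m≤n⇒m<n∨m≡n; <-≤-trans; +-monoʳ-<;
           +-commutativeSemigroup)
  open import Data.Nat.ListAction using (sum)
  open import Data.Nat.Tactic.RingSolver using (solve-∀)
  open import Data.List using ([]; _∷_; map; length; _∷ʳ_)
  open import Data.Sum using (inj₁; inj₂)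
  open import Function using (_∘_)
  open import Relation.Binary.PropositionalEquality
  open import Algebra.Properties.CommutativeSemigroup +-commutativeSemigroup using (interchange)
  open ≡-Reasoning

  infix 8 _⟪_⟫

  -- A coefficient list cs, constant term first, stands for a polynomial p, and cs ⟪ f ⟫ is the
  -- value at 0 of p(E) f, where E f = f ∘ suc is the shift.
  _⟪_⟫ : List ℕ → (ℕ → ℕ) → ℕ
  []       ⟪ f ⟫ = 0
  (c ∷ cs) ⟪ f ⟫ = c * f 0 + cs ⟪ f ∘ suc ⟫

  ⟪⟫-cong-< : ∀ cs {f g : ℕ → ℕ} → (∀ {k} → k < length cs → f k ≡ g k) →
              cs ⟪ f ⟫ ≡ cs ⟪ g ⟫
  ⟪⟫-cong-< []       eq = refl
  ⟪⟫-cong-< (c ∷ cs) eq =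
    cong₂ (λ x y → c * x + y) (eq (s≤s z≤n)) (⟪⟫-cong-< cs (eq ∘ s≤s))

  ⟪⟫-cong : ∀ cs {f g : ℕ → ℕ} → (∀ k → f k ≡ g k) → cs ⟪ f ⟫ ≡ cs ⟪ g ⟫
  ⟪⟫-cong cs eq = ⟪⟫-cong-< cs (λ {k} _ → eq k)

  ⟪⟫-zero : ∀ cs → cs ⟪ (λ _ → 0) ⟫ ≡ 0
  ⟪⟫-zero []       = refl
  ⟪⟫-zero (c ∷ cs) = cong₂ _+_ (*-zeroʳ c) (⟪⟫-zero cs)

  ⟪⟫-+ : ∀ cs (f g : ℕ → ℕ) → cs ⟪ (λ k → f k + g k) ⟫ ≡ cs ⟪ f ⟫ + cs ⟪ g ⟫
  ⟪⟫-+ []       f g = refl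
  ⟪⟫-+ (c ∷ cs) f g = begin
    c * (f 0 + g 0) + cs ⟪ (λ k → f (suc k) + g (suc k)) ⟫
      ≡⟨ cong₂ _+_ (*-distribˡ-+ c (f 0) (g 0)) (⟪⟫-+ cs (f ∘ suc) (g ∘ suc)) ⟩
    (c * f 0 + c * g 0) + (cs ⟪ f ∘ suc ⟫ + cs ⟪ g ∘ suc ⟫)
      ≡⟨ interchange (c * f 0) (c * g 0) _ _ ⟩
    (c * f 0 + cs ⟪ f ∘ suc ⟫) + (c * g 0 + cs ⟪ g ∘ suc ⟫) ∎

  ⟪⟫-*ˡ : ∀ cs d (f : ℕ → ℕ) → cs ⟪ (λ k → d * f k) ⟫ ≡ d * cs ⟪ f ⟫
  ⟪⟫-*ˡ []       d f = sym (*-zeroʳ d)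
  ⟪⟫-*ˡ (c ∷ cs) d f = begin
    c * (d * f 0) + cs ⟪ (λ k → d * f (suc k)) ⟫
      ≡⟨ cong (c * (d * f 0) +_) (⟪⟫-*ˡ cs d (f ∘ suc)) ⟩
    c * (d * f 0) + d * cs ⟪ f ∘ suc ⟫
      ≡⟨ pull-out c d (f 0) _ ⟩
    d * (c * f 0 + cs ⟪ f ∘ suc ⟫) ∎
    where
    pull-out : ∀ c d x y → c * (d * x) + d * y ≡ d * (c * x + y)
    pull-out = solve-∀

  ⟪⟫-sum : ∀ {A : Set} cs (h : ℕ → A → ℕ) xs →
           cs ⟪ (λ k → sum (map (h k) xs)) ⟫ ≡ sum (map (λ x → cs ⟪ (λ k → h k x) ⟫) xs)
  ⟪⟫-sum cs h []       = ⟪⟫-zero cs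
  ⟪⟫-sum cs h (x ∷ xs) = trans (⟪⟫-+ cs (λ k → h k x) (λ k → sum (map (h k) xs)))
                                (cong (cs ⟪ (λ k → h k x) ⟫ +_) (⟪⟫-sum cs h xs))

  ⟪⟫-∷ʳ : ∀ cs c (f : ℕ → ℕ) → (cs ∷ʳ c) ⟪ f ⟫ ≡ cs ⟪ f ⟫ + c * f (length cs)
  ⟪⟫-∷ʳ []       c f = +-identityʳ (c * f 0)
  ⟪⟫-∷ʳ (d ∷ cs) c f =
    trans (cong (d * f 0 +_) (⟪⟫-∷ʳ cs c (f ∘ suc))) (sym (+-assoc (d * f 0) _ _))

  -- spread p is p(x²).
  spread : List ℕ → List ℕ
  spread []       = []
  spread (c ∷ cs) = c ∷ 0 ∷ spread cs

  ⟪⟫-spread : ∀ cs (f : ℕ → ℕ) → spread cs ⟪ f ⟫ ≡ cs ⟪ (λ k → f (2 * k)) ⟫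
  ⟪⟫-spread []       f = refl
  ⟪⟫-spread (c ∷ cs) f = cong (c * f 0 +_) (trans (⟪⟫-spread cs (f ∘ suc ∘ suc))
                                                   (⟪⟫-cong cs (λ k → cong f (sym (*-suc 2 k)))))

  -- p(E) f = q(E) f: the characteristic polynomial p - q is split into two halves with
  -- coefficients in ℕ.  A record rather than a function type, so that unification never
  -- unfolds it: on closed instances that would re-evaluate the sequences term by term.
  record Satisfies (p q : List ℕ) (f : ℕ → ℕ) : Set where
    field
      at : ∀ m → p ⟪ (λ k → f (m + k)) ⟫ ≡ q ⟪ (λ k → f (m + k)) ⟫

  open Satisfies public

  module _ {p q : List ℕ} where

    satisfies-+ : ∀ {f g} → Satisfies p q f → Satisfies p q g → Satisfies p q (λ k → f k + g k)
    satisfies-+ {f} {g} sf sg .at m = begin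
      p ⟪ (λ k → f (m + k) + g (m + k)) ⟫
        ≡⟨ ⟪⟫-+ p _ _ ⟩
      p ⟪ (λ k → f (m + k)) ⟫ + p ⟪ (λ k → g (m + k)) ⟫
        ≡⟨ cong₂ _+_ (sf .at m) (sg .at m) ⟩
      q ⟪ (λ k → f (m + k)) ⟫ + q ⟪ (λ k → g (m + k)) ⟫
        ≡⟨ ⟪⟫-+ q _ _ ⟨
      q ⟪ (λ k → f (m + k) + g (m + k)) ⟫ ∎

    satisfies-*ˡ : ∀ d {f} → Satisfies p q f → Satisfies p q (λ k → d * f k)
    satisfies-*ˡ d {f} sf .at m = begin
      p ⟪ (λ k → d * f (m + k)) ⟫ ≡⟨ ⟪⟫-*ˡ p d _ ⟩
      d * p ⟪ (λ k → f (m + k)) ⟫ ≡⟨ cong (d *_) (sf .at m) ⟩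
      d * q ⟪ (λ k → f (m + k)) ⟫ ≡⟨ ⟪⟫-*ˡ q d _ ⟨
      q ⟪ (λ k → d * f (m + k)) ⟫ ∎

    satisfies-^ : ∀ μ → p ⟪ μ ^_ ⟫ ≡ q ⟪ μ ^_ ⟫ → Satisfies p q (μ ^_)
    satisfies-^ μ root .at m = begin
      p ⟪ (λ k → μ ^ (m + k)) ⟫ ≡⟨ shifted p ⟩
      μ ^ m * p ⟪ μ ^_ ⟫        ≡⟨ cong (μ ^ m *_) root ⟩
      μ ^ m * q ⟪ μ ^_ ⟫        ≡⟨ shifted q ⟨
      q ⟪ (λ k → μ ^ (m + k)) ⟫ ∎
      where
      shifted : ∀ cs → cs ⟪ (λ k → μ ^ (m + k)) ⟫ ≡ μ ^ m * cs ⟪ μ ^_ ⟫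
      shifted cs = trans (⟪⟫-cong cs (^-distribˡ-+-* μ m)) (⟪⟫-*ˡ cs (μ ^ m) (μ ^_))

  satisfies-spread : ∀ {p q f} → Satisfies (spread p) (spread q) f →
                     ∀ a → Satisfies p q (λ k → f (a + 2 * k))
  satisfies-spread {p} {q} {f} sf a .at m = begin
    p ⟪ (λ k → f (a + 2 * (m + k))) ⟫      ≡⟨ dilated p ⟩
    spread p ⟪ (λ k → f (a + 2 * m + k)) ⟫ ≡⟨ sf .at (a + 2 * m) ⟩
    spread q ⟪ (λ k → f (a + 2 * m + k)) ⟫ ≡⟨ dilated q ⟨
    q ⟪ (λ k → f (a + 2 * (m + k))) ⟫      ∎
    where
    reassoc : ∀ a m k → a + 2 * m + 2 * k ≡ a + 2 * (m + k)
    reassoc = solve-∀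

    dilated : ∀ cs → cs ⟪ (λ k → f (a + 2 * (m + k))) ⟫ ≡
                     spread cs ⟪ (λ k → f (a + 2 * m + k)) ⟫
    dilated cs = sym (trans (⟪⟫-spread cs _) (⟪⟫-cong cs (λ k → cong f (reassoc a m k))))

  satisfies-unique : ∀ ps q {f g} → length q ≤ length ps →
                     Satisfies (ps ∷ʳ 1) q f → Satisfies (ps ∷ʳ 1) q g →
                     (∀ {k} → k < length ps → f k ≡ g k) → ∀ k → f k ≡ g k
  satisfies-unique ps q {f} {g} q≤ps sf sg initially k = agree (suc k) (s≤s (m≤m+n k d))
    where
    d = length ps

    agree : ∀ m {k} → k < m + d → f k ≡ g k
    next  : ∀ m → f (m + d) ≡ g (m + d)

    agree zero          k<d     = initially k<d
    agree (suc m) {k} k<1+m+d with m≤n⇒m<n∨m≡n (≤-pred k<1+m+d)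
    ... | inj₁ k<m+d = agree m k<m+d
    ... | inj₂ refl  = next m

    next m = +-cancelˡ-≡ (ps ⟪ G ⟫) _ _ (begin
      ps ⟪ G ⟫ + f (m + d) ≡⟨ cong (_+ f (m + d)) (⟪⟫-cong-< ps window) ⟨
      ps ⟪ F ⟫ + f (m + d) ≡⟨ monic F ⟨
      (ps ∷ʳ 1) ⟪ F ⟫      ≡⟨ sf .at m ⟩
      q ⟪ F ⟫              ≡⟨ ⟪⟫-cong-< q (λ k<q → window (<-≤-trans k<q q≤ps)) ⟩
      q ⟪ G ⟫              ≡⟨ sg .at m ⟨
      (ps ∷ʳ 1) ⟪ G ⟫      ≡⟨ monic G ⟩
      ps ⟪ G ⟫ + g (m + d) ∎)
      where
      F G : ℕ → ℕ
      F k = f (m + k)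
      G k = g (m + k)

      window : ∀ {k} → k < d → F k ≡ G k
      window k<d = agree m (+-monoʳ-< m k<d)

      monic : ∀ h → (ps ∷ʳ 1) ⟪ h ⟫ ≡ ps ⟪ h ⟫ + h d
      monic h = trans (⟪⟫-∷ʳ ps 1 h) (cong (ps ⟪ h ⟫ +_) (*-identityˡ (h d)))

module Walks {k} (rows : Vec (List (Fin k)) k) where

  open import Data.Nat using (zero; suc; _+_; _*_)
  open import Data.Nat.Properties using (_≟_)
  open import Data.Nat.ListAction using (sum)
  open import Data.Vec using (lookup; tabulate; replicate; zipWith)
  import Data.Vec as Vec
  import Data.Vec.Properties as Vecₚ
  open import Data.List using ([]; _∷_; map)
  import Data.List.Properties as Listₚ
  open import Relation.Nullary.Decidable using (True; toWitness)
  open import Relation.Binary.PropositionalEquality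
  open ≡-Reasoning
  open LinearRecurrences

  step : Vec ℕ k → Vec ℕ k
  step v = tabulate (λ i → sum (map (lookup v) (lookup rows i)))

  orbit : Vec ℕ k → ℕ → Vec ℕ k
  orbit v zero    = v
  orbit v (suc n) = orbit (step v) n

  orbit-step : ∀ v n → orbit (step v) n ≡ step (orbit v n)
  orbit-step v zero    = refl
  orbit-step v (suc n) = orbit-step (step v) n

  orbit-+ : ∀ v m n → orbit v (m + n) ≡ orbit (orbit v m) n
  orbit-+ v zero    n = refl
  orbit-+ v (suc m) n = orbit-+ (step v) m n

  trajectory : Vec ℕ k → Fin k → ℕ → ℕ
  trajectory v i n = lookup (orbit v n) i

  -- Computes every cs ⟪ trajectory v i ⟫ at once, evaluating each iterate of step a single time.
  combination : List ℕ → Vec ℕ k → Vec ℕ k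
  combination []       v = replicate k 0
  combination (c ∷ cs) v = zipWith _+_ (Vec.map (c *_) v) (combination cs (step v))

  lookup-combination : ∀ cs v i → lookup (combination cs v) i ≡ cs ⟪ trajectory v i ⟫
  lookup-combination []       v i = Vecₚ.lookup-replicate i 0
  lookup-combination (c ∷ cs) v i = begin
    lookup (zipWith _+_ (Vec.map (c *_) v) (combination cs (step v))) i
      ≡⟨ Vecₚ.lookup-zipWith _+_ i (Vec.map (c *_) v) (combination cs (step v)) ⟩
    lookup (Vec.map (c *_) v) i + lookup (combination cs (step v)) i
      ≡⟨ cong₂ _+_ (Vecₚ.lookup-map i (c *_) v) (lookup-combination cs (step v) i) ⟩
    c * lookup v i + cs ⟪ trajectory (step v) i ⟫ ∎

  ⟪⟫-trajectory-step : ∀ cs v i →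
    cs ⟪ trajectory (step v) i ⟫ ≡ sum (map (λ j → cs ⟪ trajectory v j ⟫) (lookup rows i))
  ⟪⟫-trajectory-step cs v i = begin
    cs ⟪ trajectory (step v) i ⟫
      ≡⟨ ⟪⟫-cong cs (λ n → trans (cong (λ u → lookup u i) (orbit-step v n))
                                  (Vecₚ.lookup∘tabulate _ i)) ⟩
    cs ⟪ (λ n → sum (map (lookup (orbit v n)) (lookup rows i))) ⟫
      ≡⟨ ⟪⟫-sum cs (λ n j → lookup (orbit v n) j) (lookup rows i) ⟩
    sum (map (λ j → cs ⟪ trajectory v j ⟫) (lookup rows i)) ∎

  -- Stated with True so that for closed p, q and v the hypothesis is discharged by evaluation.
  satisfies-trajectory : ∀ p q v → True (Vecₚ.≡-dec _≟_ (combination p v) (combination q v)) →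
                         ∀ i → Satisfies p q (trajectory v i)
  satisfies-trajectory p q v initially i .at m = begin
    p ⟪ (λ n → trajectory v i (m + n)) ⟫ ≡⟨ ⟪⟫-cong p (along m) ⟩
    p ⟪ trajectory (orbit v m) i ⟫       ≡⟨ holds-orbit m v holds-initially i ⟩
    q ⟪ trajectory (orbit v m) i ⟫       ≡⟨ ⟪⟫-cong q (along m) ⟨
    q ⟪ (λ n → trajectory v i (m + n)) ⟫ ∎
    where
    Holds : Vec ℕ k → Set
    Holds u = ∀ j → p ⟪ trajectory u j ⟫ ≡ q ⟪ trajectory u j ⟫

    holds-initially : Holds v
    holds-initially j = begin
      p ⟪ trajectory v j ⟫        ≡⟨ lookup-combination p v j ⟨
      lookup (combination p v) j ≡⟨ cong (λ u → lookup u j) (toWitness initially) ⟩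
      lookup (combination q v) j ≡⟨ lookup-combination q v j ⟩
      q ⟪ trajectory v j ⟫        ∎

    holds-step : ∀ u → Holds u → Holds (step u)
    holds-step u h j = begin
      p ⟪ trajectory (step u) j ⟫
        ≡⟨ ⟪⟫-trajectory-step p u j ⟩
      sum (map (λ l → p ⟪ trajectory u l ⟫) (lookup rows j))
        ≡⟨ cong sum (Listₚ.map-cong h (lookup rows j)) ⟩
      sum (map (λ l → q ⟪ trajectory u l ⟫) (lookup rows j))
        ≡⟨ ⟪⟫-trajectory-step q u j ⟨
      q ⟪ trajectory (step u) j ⟫ ∎

    holds-orbit : ∀ m u → Holds u → Holds (orbit u m)
    holds-orbit zero    u h = h
    holds-orbit (suc m) u h = holds-orbit m (step u) (holds-step u h)

    along : ∀ m n → trajectory v i (m + n) ≡ trajectory (orbit v m) i n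
    along m n = cong (λ u → lookup u i) (orbit-+ v m n)

module WordCounts where

  open import Data.Nat using (suc; _+_)
  open import Data.Nat.ListAction using (sum)
  open import Data.Vec using ([]; _∷_)
  open import Data.List using ([]; _∷_; map; length; filter; concatMap; allFin; _++_)
  import Data.List.Properties as Listₚ
  open import Data.Product using (_,_)
  open import Data.Bool using (true; false)
  open import Function using (_∘_)
  open import Relation.Nullary using (Dec; does)
  open import Relation.Unary using (Pred; Decidable)
  open import Relation.Binary.PropositionalEquality
  open ≡-Reasoning

  module _ {A B : Set} {p} {P : Pred B p} (P? : Decidable P) where

    length-filter-map : ∀ (g : A → B) xs →
                        length (filter P? (map g xs)) ≡ length (filter (P? ∘ g) xs)
    length-filter-map g []       = refl
    length-filter-map g (x ∷ xs) with does (P? (g x))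
    ... | true  = cong suc (length-filter-map g xs)
    ... | false = length-filter-map g xs

    length-filter-concatMap : ∀ (f : A → List B) xs →
      length (filter P? (concatMap f xs)) ≡ sum (map (λ x → length (filter P? (f x))) xs)
    length-filter-concatMap f []       = refl
    length-filter-concatMap f (x ∷ xs) = begin
      length (filter P? (f x ++ concatMap f xs))
        ≡⟨ cong length (Listₚ.filter-++ P? (f x) (concatMap f xs)) ⟩
      length (filter P? (f x) ++ filter P? (concatMap f xs))
        ≡⟨ Listₚ.length-++ (filter P? (f x)) ⟩
      length (filter P? (f x)) + length (filter P? (concatMap f xs))
        ≡⟨ cong (length (filter P? (f x)) +_) (length-filter-concatMap f xs) ⟩
      length (filter P? (f x)) + sum (map (λ x → length (filter P? (f x))) xs) ∎

  run : ∀ {n} → Vec Z8 n → Mat → Mat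
  run []       X = X
  run (a ∷ as) X = run as (S a · X)

  -- M runs an accumulator loop local to its where block, which cannot be named.  The meta
  -- loop is solved to it by unification (the with-abstraction turns the arguments into
  -- variables, so that the constraint is a pattern), which makes the loop available with an
  -- arbitrary accumulator.
  private
    mutual
      loop : ∀ {n} → Vec Z8 n → ∀ {k} → Vec Z8 k → Mat → Mat
      loop = _

      M-unfold : ∀ {k} a (as : Vec Z8 k) → M (a ∷ as) ≡ loop (a ∷ as) as (S a · Id)
      M-unfold {k} a as with suc k | a ∷ as | S a · Id
      ... | _ | _ | _ = refl

    loop≡run : ∀ {n} (w : Vec Z8 n) {k} (as : Vec Z8 k) X → loop w as X ≡ run as X
    loop≡run w []       X = refl
    loop≡run w (a ∷ as) X = loop≡run w as (S a · X)

  M≡run : ∀ {n} (v : Vec Z8 n) → M v ≡ run v Id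
  M≡run []       = refl
  M≡run (a ∷ as) = trans (M-unfold a as) (loop≡run (a ∷ as) as (S a · Id))

  count : ℕ → Mat → Mat → ℕ
  count n X B = length (filter (λ v → run v X ≟M B) (tuples n))

  count-suc : ∀ n X B → count (suc n) X B ≡ sum (map (λ a → count n (S a · X) B) (allFin 8))
  count-suc n X B = trans
    (length-filter-concatMap reaches (λ a → map (a ∷_) (tuples n)) (allFin 8))
    (cong sum (Listₚ.map-cong (λ a → length-filter-map reaches (a ∷_) (tuples n)) (allFin 8)))
    where
    reaches : ∀ {n} (v : Vec Z8 n) → Dec (run v X ≡ B)
    reaches v = run v X ≟M B

  count-from-Id : ∀ n B → length (filter (λ v → M v ≟M B) (tuples n)) ≡ count n Id B
  count-from-Id n B = cong length (Listₚ.filter-≐ (λ v → M v ≟M B) (λ v → run v Id ≟M B)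
    ((λ {v} → trans (sym (M≡run v))) , (λ {v} → trans (M≡run v))) (tuples n))

module Lumping {k} (classOf : Mat → Fin k) (representative : Fin k → Mat) where

  open import Data.Nat using (zero; suc)
  open import Data.Nat.ListAction using (sum)
  open import Data.Nat.ListAction.Properties using (sum-↭)
  open import Data.Vec using (lookup; tabulate)
  import Data.Vec.Properties as Vecₚ
  open import Data.List using (map; allFin)
  import Data.List.Properties as Listₚ
  open import Data.List.Relation.Binary.Permutation.Propositional using (_↭_)
  open import Data.List.Relation.Binary.Permutation.Propositional.Properties using (map⁺)
  open import Function using (_∘_)
  open import Relation.Binary.PropositionalEquality
  open ≡-Reasoning
  open WordCounts

  successorClasses : Mat → List (Fin k)
  successorClasses X = map (λ a → classOf (S a · X)) (allFin 8)

  transitions : Vec (List (Fin k)) k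
  transitions = tabulate (successorClasses ∘ representative)

  open Walks transitions public

  initial : Mat → Vec ℕ k
  initial B = tabulate (λ i → count 0 (representative i) B)

  count≡trajectory : (∀ X → successorClasses X ↭ successorClasses (representative (classOf X))) →
                     ∀ B → (∀ X → count 0 X B ≡ count 0 (representative (classOf X)) B) →
                     ∀ n X → count n X B ≡ trajectory (initial B) (classOf X) n
  count≡trajectory lumpable B start zero    X =
    trans (start X) (sym (Vecₚ.lookup∘tabulate _ (classOf X)))
  count≡trajectory lumpable B start (suc n) X = begin
    count (suc n) X B
      ≡⟨ count-suc n X B ⟩
    sum (map (λ a → count n (S a · X) B) (allFin 8))
      ≡⟨ cong sum (Listₚ.map-cong (λ a → count≡trajectory lumpable B start n (S a · X))
                                  (allFin 8)) ⟩
    sum (map (λ a → c (classOf (S a · X))) (allFin 8))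
      ≡⟨ cong sum (Listₚ.map-∘ {g = c} {f = λ a → classOf (S a · X)} (allFin 8)) ⟩
    sum (map c (successorClasses X))
      ≡⟨ sum-↭ (map⁺ c (lumpable X)) ⟩
    sum (map c (successorClasses (representative (classOf X))))
      ≡⟨ cong (sum ∘ map c) (Vecₚ.lookup∘tabulate _ (classOf X)) ⟨
    sum (map c (lookup transitions (classOf X)))
      ≡⟨ Vecₚ.lookup∘tabulate _ (classOf X) ⟨
    lookup (step (orbit (initial B) n)) (classOf X)
      ≡⟨ cong (λ u → lookup u (classOf X)) (orbit-step (initial B) n) ⟨
    trajectory (initial B) (classOf X) (suc n) ∎
    where
    c : Fin k → ℕ
    c = lookup (orbit (initial B) n)

module FirstRowClasses where

  open import Data.Nat using (_+_; _*_; _%_)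
  open import Data.Nat.Properties using (_≟_)
  open import Data.Fin using (#_; toℕ; _↑ʳ_; splitAt; combine; remQuot)
  import Data.Fin.Properties as Finₚ
  open import Data.Vec using ([]; _∷_; lookup)
  import Data.List.Properties as Listₚ
  open import Data.List.Relation.Binary.Permutation.Propositional
    using (_↭_; ↭-sym; ↭-trans; ↭-reflexive)
  open import Data.List.Sort.InsertionSort.Base (Finₚ.≤-decTotalOrder 67) using (sort)
  open import Data.List.Sort.InsertionSort.Properties (Finₚ.≤-decTotalOrder 67) using (sort-↭)
  open import Data.Product using (_,_; uncurry)
  open import Data.Sum using (_⊎_; inj₁; inj₂)
  open import Relation.Nullary using (Dec; yes; no)
  open import Relation.Nullary.Decidable using (toWitness; map′)
  open import Relation.Binary.PropositionalEquality
  open WordCounts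

  det : Mat → Z8
  det ((a , b) , (c , d)) = a *₈ d +₈ -₈ (b *₈ c)

  -- A matrix of determinant 1 other than ±Id with first row (a , b), whenever that row is
  -- unimodular: odd residues mod 8 square to 1.
  completion : Z8 → Z8 → Mat
  completion a b with toℕ a % 2
  ... | 0 = ((a , b) , (-₈ b , 0₈))
  ... | _ = ((a , b) , (1₈ , a *₈ (1₈ +₈ b)))

  Class : Set
  Class = Fin (3 + 8 * 8)

  -- Id and -Id get classes of their own, as walks of length 0 tell them apart from the other
  -- matrices with the same first row.
  classOf : Mat → Class
  classOf X@((a , b) , _) with det X Finₚ.≟ 1₈ | X ≟M Id | X ≟M -Id
  ... | no _  | _     | _     = # 0
  ... | yes _ | yes _ | _     = # 1
  ... | yes _ | no _  | yes _ = # 2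
  ... | yes _ | no _  | no _  = 3 ↑ʳ combine a b

  representative : Class → Mat
  representative i with splitAt 3 i
  ... | inj₁ j = lookup (((0₈ , 0₈) , (0₈ , 0₈)) ∷ Id ∷ -Id ∷ []) j
  ... | inj₂ r = uncurry completion (remQuot {8} 8 r)

  open Lumping classOf representative public

  all-Mat? : {P : Mat → Set} → ((X : Mat) → Dec (P X)) → Dec ((X : Mat) → P X)
  all-Mat? P? = map′ (λ h ((a , b) , (c , d)) → h a b c d) (λ h a b c d → h ((a , b) , (c , d)))
    (Finₚ.all? λ a → Finₚ.all? λ b → Finₚ.all? λ c → Finₚ.all? λ d → P? ((a , b) , (c , d)))

  lumpable : ∀ X → successorClasses X ↭ successorClasses (representative (classOf X))
  lumpable X = ↭-trans (↭-sym (sort-↭ _)) (↭-trans (↭-reflexive (sorted X)) (sort-↭ _))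
    where
    sorted : ∀ X → sort (successorClasses X) ≡ sort (successorClasses (representative (classOf X)))
    sorted = toWitness {a? = all-Mat? (λ X → Listₚ.≡-dec Finₚ._≟_ _ _)} _

  ±Id-singleton : ∀ B → B ≡ Id ⊎ B ≡ -Id →
                  ∀ X → count 0 X B ≡ count 0 (representative (classOf X)) B
  ±Id-singleton B (inj₁ refl) =
    toWitness {a? = all-Mat? (λ X → count 0 X Id ≟ count 0 (representative (classOf X)) Id)} _
  ±Id-singleton B (inj₂ refl) =
    toWitness {a? = all-Mat? (λ X → count 0 X -Id ≟ count 0 (representative (classOf X)) -Id)} _

module ClosedForms where

  open import Data.Nat using (_+_; _*_; _^_; _<_)
  open import Data.Nat.Properties using (_≟_; ≤-refl; allUpTo?)
  open import Data.Nat.Tactic.RingSolver using (solve-∀)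
  open import Data.List using ([]; _∷_; _∷ʳ_)
  open import Data.Sum using (_⊎_; inj₁; inj₂)
  open import Relation.Nullary.Decidable using (toWitness)
  open import Relation.Binary.PropositionalEquality
  open LinearRecurrences
  open WordCounts
  open FirstRowClasses

  walks : Mat → ℕ → ℕ
  walks B = trajectory (initial B) (classOf Id)

  w⁺≡walks : ∀ n → w⁺ n ≡ walks Id n
  w⁺≡walks n = trans (count-from-Id n Id)
                     (count≡trajectory lumpable Id (±Id-singleton Id (inj₁ refl)) n Id)

  w⁻≡walks : ∀ n → w⁻ n ≡ walks -Id n
  w⁻≡walks n = trans (count-from-Id n -Id)
                     (count≡trajectory lumpable -Id (±Id-singleton -Id (inj₂ refl)) n Id)

  -- P₊ - P₋ = (y - 8)(y + 8)(y - 16)(y + 16)(y - 64).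
  P₊-lower P₋ : List ℕ
  P₊-lower = 0 ∷ 16384 ∷ 20480 ∷ 0 ∷ 0 ∷ []
  P₋       = 1048576 ∷ 0 ∷ 0 ∷ 320 ∷ 64 ∷ []

  P₊ : List ℕ
  P₊ = P₊-lower ∷ʳ 1

  walks-recurrence : ∀ B → B ≡ Id ⊎ B ≡ -Id →
                     Satisfies (spread P₊) (spread P₋) (λ n → walks B (2 + n))
  walks-recurrence B (inj₁ refl) =
    satisfies-trajectory (spread P₊) (spread P₋) (orbit (initial Id) 2) _ (classOf Id)
  walks-recurrence B (inj₂ refl) =
    satisfies-trajectory (spread P₊) (spread P₋) (orbit (initial -Id) 2) _ (classOf Id)

  odd-walks : ∀ B → B ≡ Id ⊎ B ≡ -Id →
              ∀ k → 3 * walks B (5 + 2 * k) + 16 * 16 ^ k ≡ 256 * 64 ^ k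
  odd-walks B B≡±Id = satisfies-unique P₊-lower P₋ ≤-refl
    (satisfies-+ (satisfies-*ˡ 3 (satisfies-spread (walks-recurrence B B≡±Id) 3))
                 (satisfies-*ˡ 16 (satisfies-^ 16 refl)))
    (satisfies-*ˡ 256 (satisfies-^ 64 refl))
    (initially B B≡±Id)
    where
    initially : ∀ B → B ≡ Id ⊎ B ≡ -Id →
                ∀ {k} → k < 5 → 3 * walks B (5 + 2 * k) + 16 * 16 ^ k ≡ 256 * 64 ^ k
    initially B (inj₁ refl) =
      toWitness {a? = allUpTo? (λ k → 3 * walks Id (5 + 2 * k) + 16 * 16 ^ k ≟ 256 * 64 ^ k) 5} _
    initially B (inj₂ refl) =
      toWitness {a? = allUpTo? (λ k → 3 * walks -Id (5 + 2 * k) + 16 * 16 ^ k ≟ 256 * 64 ^ k) 5} _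

  even-walks : ∀ k → 3 * (walks Id (4 + 2 * k) + walks -Id (4 + 2 * k)) ≡
                     12 * 8 ^ k + 8 * 16 ^ k + 64 * 64 ^ k
  even-walks = satisfies-unique P₊-lower P₋ ≤-refl
    (satisfies-*ˡ 3 (satisfies-+ (satisfies-spread (walks-recurrence Id (inj₁ refl)) 2)
                                 (satisfies-spread (walks-recurrence -Id (inj₂ refl)) 2)))
    (satisfies-+ (satisfies-+ (satisfies-*ˡ 12 (satisfies-^ 8 refl)) (satisfies-*ˡ 8 (satisfies-^ 16 refl)))
                 (satisfies-*ˡ 64 (satisfies-^ 64 refl)))
    (toWitness {a? = allUpTo? (λ k → 3 * (walks Id (4 + 2 * k) + walks -Id (4 + 2 * k))
                                      ≟ 12 * 8 ^ k + 8 * 16 ^ k + 64 * 64 ^ k) 5} _)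

  odd-index : ∀ m → 2 * (2 + m) + 1 ≡ 5 + 2 * m
  odd-index = solve-∀

  even-index : ∀ m → 2 * (2 + m) ≡ 4 + 2 * m
  even-index = solve-∀

  w⁺-odd : ∀ m → 3 * w⁺ (2 * (2 + m) + 1) + 16 * 16 ^ m ≡ 256 * 64 ^ m
  w⁺-odd m = trans
    (cong (λ t → 3 * t + 16 * 16 ^ m)
          (trans (w⁺≡walks (2 * (2 + m) + 1)) (cong (walks Id) (odd-index m))))
    (odd-walks Id (inj₁ refl) m)

  w⁻-odd : ∀ m → 3 * w⁻ (2 * (2 + m) + 1) + 16 * 16 ^ m ≡ 256 * 64 ^ m
  w⁻-odd m = trans
    (cong (λ t → 3 * t + 16 * 16 ^ m)
          (trans (w⁻≡walks (2 * (2 + m) + 1)) (cong (walks -Id) (odd-index m))))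
    (odd-walks -Id (inj₂ refl) m)

  w-even : ∀ m → 3 * w (2 * (2 + m)) ≡ 12 * 8 ^ m + 8 * 16 ^ m + 64 * 64 ^ m
  w-even m = trans
    (cong₂ (λ s t → 3 * (s + t)) (trans (w⁺≡walks (2 * (2 + m))) (cong (walks Id) (even-index m)))
                                 (trans (w⁻≡walks (2 * (2 + m))) (cong (walks -Id) (even-index m))))
    (even-walks m)

module Arithmetic where

  open import Data.Nat using (_+_; _*_; _^_; _∸_; _/_; _≤_; NonZero)
  open import Data.Nat.Properties
    using (+-comm; +-assoc; *-comm; +-cancelˡ-≡; m+n∸m≡n; m+[n∸m]≡n; *-distribˡ-∸;
           ^-distribˡ-+-*; ^-*-assoc; ^-monoˡ-≤; *-cancelˡ-≤; +-mono-≤; +-monoʳ-≤; *-monoʳ-≤;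
           ≤-reflexive; ≤-trans; m≤m+n)
  open import Data.Nat.DivMod using (m*n/n≡m)
  open import Data.Nat.Tactic.RingSolver using (solve-∀)
  open import Data.Integer using (+_; _-_) renaming (_+_ to _+ℤ_)
  open import Data.Integer.DivMod using (div-pos-is-/ℕ) renaming (_/_ to _/ℤ_)
  import Data.Integer.Properties as ℤₚ
  import Data.Integer.Tactic.RingSolver as ℤ-RingSolver
  open import Relation.Binary.PropositionalEquality
  open ≡-Reasoning

  m≡n+o⇒m∸n≡o : ∀ {m} n {o} → m ≡ n + o → m ∸ n ≡ o
  m≡n+o⇒m∸n≡o n {o} refl = m+n∸m≡n n o

  ^-affine : ∀ b {e} c a k → e ≡ c + a * k → b ^ e ≡ b ^ c * (b ^ a) ^ k
  ^-affine b c a k refl = trans (^-distribˡ-+-* b c (a * k)) (cong (b ^ c *_) (sym (^-*-assoc b a k)))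

  exact-quotient : ∀ d t s r .{{_ : NonZero d}} → d * t + s ≡ r → t ≡ (r ∸ s) / d
  exact-quotient d t s r eq = sym (begin
    (r ∸ s) / d ≡⟨ cong (_/ d) (m≡n+o⇒m∸n≡o s (trans (sym eq) (+-comm (d * t) s))) ⟩
    d * t / d   ≡⟨ cong (_/ d) (*-comm d t) ⟩
    t * d / d   ≡⟨ m*n/n≡m t d ⟩
    t           ∎)

  odd-formula : ∀ m t → 3 * t + 16 * 16 ^ m ≡ 256 * 64 ^ m →
                t ≡ (2 ^ (6 * (2 + m) ∸ 2 * (2 + m) ∸ 7) * (2 ^ (2 * (2 + m) + 3) ∸ 8)) / 3
  odd-formula m t eq = trans (exact-quotient 3 t _ _ eq) (cong (_/ 3) (sym numerator))
    where
    exponent₀ : ∀ m → 6 * (2 + m) ≡ 2 * (2 + m) + (8 + 4 * m)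
    exponent₀ = solve-∀

    exponent₁ : ∀ m → 1 + 4 * m + (2 * (2 + m) + 3) ≡ 8 + 6 * m
    exponent₁ = solve-∀

    exponent₂ : ∀ m → 1 + 4 * m + 3 ≡ 4 + 4 * m
    exponent₂ = solve-∀

    a = 1 + 4 * m
    b = 2 * (2 + m) + 3

    numerator : 2 ^ (6 * (2 + m) ∸ 2 * (2 + m) ∸ 7) * (2 ^ b ∸ 8) ≡ 256 * 64 ^ m ∸ 16 * 16 ^ m
    numerator = begin
      2 ^ (6 * (2 + m) ∸ 2 * (2 + m) ∸ 7) * (2 ^ b ∸ 8)
        ≡⟨ cong (λ e → 2 ^ (e ∸ 7) * (2 ^ b ∸ 8)) (m≡n+o⇒m∸n≡o (2 * (2 + m)) (exponent₀ m)) ⟩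
      2 ^ a * (2 ^ b ∸ 2 ^ 3)
        ≡⟨ *-distribˡ-∸ (2 ^ a) (2 ^ b) (2 ^ 3) ⟩
      2 ^ a * 2 ^ b ∸ 2 ^ a * 2 ^ 3
        ≡⟨ cong₂ _∸_ (^-distribˡ-+-* 2 a b) (^-distribˡ-+-* 2 a 3) ⟨
      2 ^ (a + b) ∸ 2 ^ (a + 3)
        ≡⟨ cong₂ _∸_ (^-affine 2 8 6 m (exponent₁ m)) (^-affine 2 4 4 m (exponent₂ m)) ⟩
      256 * 64 ^ m ∸ 16 * 16 ^ m ∎

  a+c≡b+d+t⇒a-b+c-d≡t : ∀ a b c d t → a +ℤ c ≡ b +ℤ d +ℤ t → a - b +ℤ c - d ≡ t
  a+c≡b+d+t⇒a-b+c-d≡t a b c d t eq = begin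
    a - b +ℤ c - d             ≡⟨ regroup a b c d ⟩
    (a +ℤ c) - (b +ℤ d)        ≡⟨ cong (_- (b +ℤ d)) eq ⟩
    (b +ℤ d +ℤ t) - (b +ℤ d)   ≡⟨ cancel (b +ℤ d) t ⟩
    t                          ∎
    where
    regroup : ∀ a b c d → a - b +ℤ c - d ≡ (a +ℤ c) - (b +ℤ d)
    regroup = ℤ-RingSolver.solve-∀

    cancel : ∀ x t → x +ℤ t - x ≡ t
    cancel = ℤ-RingSolver.solve-∀

  even-formula′ : ∀ e q p r → q ≤ p → q ≤ r → 3 * e ≡ 12 * q + 8 * p + 64 * r →
               + e ≡ + (28 * q) +ℤ ((+ (8 * p) - + (8 * q) +ℤ + (64 * r) - + (64 * q)) /ℤ + 3)
  even-formula′ e q p r q≤p q≤r eq = sym (begin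
    + (28 * q) +ℤ ((+ (8 * p) - + (8 * q) +ℤ + (64 * r) - + (64 * q)) /ℤ + 3)
      ≡⟨ cong (λ z → + (28 * q) +ℤ (z /ℤ + 3)) numerator ⟩
    + (28 * q) +ℤ (+ (k * 3) /ℤ + 3)
      ≡⟨ cong (+ (28 * q) +ℤ_) (trans (div-pos-is-/ℕ (+ (k * 3)) 3) (cong +_ (m*n/n≡m k 3))) ⟩
    + (28 * q) +ℤ + k
      ≡⟨ ℤₚ.pos-+ (28 * q) k ⟨
    + (28 * q + k)
      ≡⟨ cong +_ (m+[n∸m]≡n 28q≤e) ⟩
    + e ∎)
    where
    split : ∀ q → 3 * (28 * q) ≡ 12 * q + 8 * q + 64 * q
    split = solve-∀

    28q≤e : 28 * q ≤ e
    28q≤e = *-cancelˡ-≤ 3 (≤-trans (≤-reflexive (split q))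
              (≤-trans (+-mono-≤ (+-monoʳ-≤ (12 * q) (*-monoʳ-≤ 8 q≤p)) (*-monoʳ-≤ 64 q≤r))
                       (≤-reflexive (sym eq))))

    k = e ∸ 28 * q

    expand : ∀ q k → 3 * (28 * q + k) ≡ 12 * q + (8 * q + 64 * q + k * 3)
    expand = solve-∀

    excess : 8 * p + 64 * r ≡ 8 * q + 64 * q + k * 3
    excess = +-cancelˡ-≡ (12 * q) _ _ (begin
      12 * q + (8 * p + 64 * r)         ≡⟨ +-assoc (12 * q) (8 * p) (64 * r) ⟨
      12 * q + 8 * p + 64 * r           ≡⟨ eq ⟨
      3 * e                             ≡⟨ cong (3 *_) (m+[n∸m]≡n 28q≤e) ⟨
      3 * (28 * q + k)                  ≡⟨ expand q k ⟩
      12 * q + (8 * q + 64 * q + k * 3) ∎)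

    numerator : + (8 * p) - + (8 * q) +ℤ + (64 * r) - + (64 * q) ≡ + (k * 3)
    numerator = a+c≡b+d+t⇒a-b+c-d≡t (+ (8 * p)) (+ (8 * q)) (+ (64 * r)) (+ (64 * q)) _ (begin
      + (8 * p) +ℤ + (64 * r)              ≡⟨ ℤₚ.pos-+ (8 * p) (64 * r) ⟨
      + (8 * p + 64 * r)                   ≡⟨ cong +_ excess ⟩
      + (8 * q + 64 * q + k * 3)           ≡⟨ ℤₚ.pos-+ (8 * q + 64 * q) (k * 3) ⟩
      + (8 * q + 64 * q) +ℤ + (k * 3)      ≡⟨ cong (_+ℤ + (k * 3)) (ℤₚ.pos-+ (8 * q) (64 * q)) ⟩
      + (8 * q) +ℤ + (64 * q) +ℤ + (k * 3) ∎)

  even-formula : ∀ m e → 3 * e ≡ 12 * 8 ^ m + 8 * 16 ^ m + 64 * 64 ^ m →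
    + e ≡ + (28 * 8 ^ m) +ℤ ((+ (2 ^ (4 * (2 + m) ∸ 5)) - + (2 ^ (3 * (2 + m) ∸ 3))
                            +ℤ + (2 ^ (6 * (2 + m) ∸ 6)) - + (2 ^ (3 * (2 + m)))) /ℤ + 3)
  even-formula m e eq = begin
    + e
      ≡⟨ even-formula′ e (8 ^ m) (16 ^ m) (64 ^ m)
                       (^-monoˡ-≤ m (m≤m+n 8 8)) (^-monoˡ-≤ m (m≤m+n 8 56)) eq ⟩
    + (28 * 8 ^ m) +ℤ ((+ (8 * 16 ^ m) - + (8 * 8 ^ m) +ℤ + (64 * 64 ^ m) - + (64 * 8 ^ m)) /ℤ + 3)
      ≡⟨ cong (λ z → + (28 * 8 ^ m) +ℤ (z /ℤ + 3)) numerator ⟨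
    + (28 * 8 ^ m) +ℤ ((+ (2 ^ (4 * (2 + m) ∸ 5)) - + (2 ^ (3 * (2 + m) ∸ 3))
                      +ℤ + (2 ^ (6 * (2 + m) ∸ 6)) - + (2 ^ (3 * (2 + m)))) /ℤ + 3) ∎
    where
    exponent₁ : ∀ m → 4 * (2 + m) ≡ 5 + (3 + 4 * m)
    exponent₁ = solve-∀

    exponent₂ : ∀ m → 3 * (2 + m) ≡ 3 + (3 + 3 * m)
    exponent₂ = solve-∀

    exponent₃ : ∀ m → 6 * (2 + m) ≡ 6 + (6 + 6 * m)
    exponent₃ = solve-∀

    exponent₄ : ∀ m → 3 * (2 + m) ≡ 6 + 3 * m
    exponent₄ = solve-∀

    power : ∀ {e} c a → e ≡ c + a * m → + (2 ^ e) ≡ + (2 ^ c * (2 ^ a) ^ m)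
    power c a e≡ = cong +_ (^-affine 2 c a m e≡)

    numerator : + (2 ^ (4 * (2 + m) ∸ 5)) - + (2 ^ (3 * (2 + m) ∸ 3))
                +ℤ + (2 ^ (6 * (2 + m) ∸ 6)) - + (2 ^ (3 * (2 + m)))
              ≡ + (8 * 16 ^ m) - + (8 * 8 ^ m) +ℤ + (64 * 64 ^ m) - + (64 * 8 ^ m)
    numerator = cong₂ _-_ (cong₂ _+ℤ_ (cong₂ _-_ (power 3 4 (m≡n+o⇒m∸n≡o 5 (exponent₁ m)))
                                                 (power 3 3 (m≡n+o⇒m∸n≡o 3 (exponent₂ m))))
                                      (power 6 6 (m≡n+o⇒m∸n≡o 6 (exponent₃ m))))
                          (power 6 3 (exponent₄ m))

open ClosedForms using (w⁺-odd; w⁻-odd; w-even)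
open Arithmetic using (odd-formula; even-formula)

open import Data.Nat using (ℕ; _≥_; _*_; _∸_; _/_)
open import Data.Integer using (ℤ; +_; _-_; _+_)
open import Data.Integer.DivMod using () renaming (_/_ to _/ℤ_)
open import Data.Product using (_×_)
open import Relation.Binary.PropositionalEquality using (_≡_)
open import Data.Nat using () renaming (_+_ to _+ℕ_; _^_ to _^_)
open import Data.Nat using (suc; s≤s; z≤n)
open import Data.Product using (_,_)

theorem1p5 : (n : ℕ) → n ≥ 2 →
    ((w⁺ (2 * n +ℕ 1) ≡ (2 ^ (6 * n ∸ 2 * n ∸ 7) * (2 ^ (2 * n +ℕ 3) ∸ 8)) / 3)
      × (w⁻ (2 * n +ℕ 1) ≡ (2 ^ (6 * n ∸ 2 * n ∸ 7) * (2 ^ (2 * n +ℕ 3) ∸ 8)) / 3))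
    × (+ w (2 * n)
        ≡ + (28 * 8 ^ (n ∸ 2))
          + ((+ (2 ^ (4 * n ∸ 5)) - + (2 ^ (3 * n ∸ 3)) + + (2 ^ (6 * n ∸ 6)) - + (2 ^ (3 * n))) /ℤ + 3))
theorem1p5 (suc (suc m)) (s≤s (s≤s z≤n)) =
  (odd-formula m _ (w⁺-odd m) , odd-formula m _ (w⁻-odd m)) , even-formula m _ (w-even m)
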